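{- Let $D$ be a digraph with at least one arc. Then for every arc $a\in A(D)$, $\dim(D)\le \dim(D-a)+2$, where $D-a$ is the digraph obtained from $D$ by deleting the arc $a$.
   Context: All digraphs are finite and have simple underlying graphs (no loops, no multiple arcs, and at most one arc between any two vertices). For an integer $d\ge 0$ write $[d]=\{1,\dots,d\}$ (with $\mathbb{R}^0=\{0\}$). For $x,y\in\mathbb{R}^d$ let $\mathcal{G}_{x>y}=\{i\in[d]: x_i>y_i\}$. The weak majority relation: $x\succ y$ iff $|\mathcal{G}_{x>y}|-|\mathcal{G}_{y>x}|>0$. A map $f:V(D)\to\mathbb{R}^d$ is an $\mathbb{R}^d$-realizer of $D$ if for all vertices $x,y$: $(x,y)\in A(D)$ iff $f(x)\succ f(y)$. The weak majority dimension $\dim(D)$ is the minimum nonnegative integer $d$ such that $D$ has an $\mathbb{R}^d$-realizer (such $d$ always exists).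
   Formalization: Realizers of D and of D−a have rational coordinates, taking values in ℚ^d rather than $\mathbb{R}^d$. -}

module Defs where

open import Data.Nat using (ℕ; zero; suc; _+_; _<_)
open import Data.Bool using (Bool; true; false; _∧_; not)
open import Data.Fin using (Fin; zero; suc)
open import Data.Fin.Properties using (_≟_)
open import Data.Rational using (ℚ) renaming (_<_ to _<ℚ_)
open import Data.Rational.Properties using (_<?_)
open import Data.Product using (Σ; _×_)
open import Function.Bundles using (_⇔_)
open import Relation.Nullary using (¬_)
open import Relation.Nullary.Decidable using (does)
open import Relation.Binary.PropositionalEquality using (_≡_)

-- A finite digraph on vertex set Fin n with simple underlying graph:
-- no loops, and at most one arc between any two vertices.
record Digraph (n : ℕ) : Set where
  field
    arc     : Fin n → Fin n → Bool
    noLoop  : ∀ i → arc i i ≡ false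
    antisym : ∀ i j → arc i j ≡ true → arc j i ≡ false
open Digraph public

IsArc : ∀ {n} → Digraph n → Fin n → Fin n → Set
IsArc D u v = arc D u v ≡ true

private
  isPair : ∀ {n} → Fin n → Fin n → Fin n → Fin n → Bool
  isPair u v i j = does (i ≟ u) ∧ does (j ≟ v)

deleteArc : ∀ {n} → Digraph n → Fin n → Fin n → Digraph n
deleteArc {n} D u v = record
  { arc = λ i j → arc D i j ∧ not (isPair u v i j)
  ; noLoop = λ i → lemL i
  ; antisym = λ i j h → lemA i j h }
  where
  open import Data.Bool.Properties using (∧-zeroˡ)
  open import Relation.Binary.PropositionalEquality using (cong; trans; subst; sym)
  ∧-true₁ : ∀ a b → (a ∧ b) ≡ true → a ≡ true
  ∧-true₁ true b _ = _≡_.refl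
  lemL : ∀ i → (arc D i i ∧ not (isPair u v i i)) ≡ false
  lemL i = trans (cong (λ z → z ∧ not (isPair u v i i)) (noLoop D i)) _≡_.refl
  lemA : ∀ i j → (arc D i j ∧ not (isPair u v i j)) ≡ true
             → (arc D j i ∧ not (isPair u v j i)) ≡ false
  lemA i j h = trans (cong (λ z → z ∧ not (isPair u v j i)) (antisym D i j (∧-true₁ _ _ h))) _≡_.refl

-- Points of ℝ^d, rendered with rational coordinates.
Point : ℕ → Set
Point d = Fin d → ℚ

countGreater : ∀ {d} → Point d → Point d → ℕ
countGreater {zero}  x y = 0
countGreater {suc d} x y =
  (if' does (y zero <? x zero) then 1 else 0) + countGreater (λ i → x (suc i)) (λ i → y (suc i))
  where
  if'_then_else_ : Bool → ℕ → ℕ → ℕ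
  if' true  then a else b = a
  if' false then a else b = b

-- weak majority relation: x ≻ y iff |G_{x>y}| - |G_{y>x}| > 0
_≻_ : ∀ {d} → Point d → Point d → Set
x ≻ y = countGreater y x < countGreater x y

IsRealizer : ∀ {n} (D : Digraph n) (d : ℕ) → (Fin n → Point d) → Set
IsRealizer D d f = ∀ x y → (IsArc D x y ⇔ (f x ≻ f y))

HasRealizer : ∀ {n} → Digraph n → ℕ → Set
HasRealizer D d = Σ (Fin _ → Point d) (IsRealizer D d)

IsDim : ∀ {n} → Digraph n → ℕ → Set
IsDim D d = HasRealizer D d × (∀ d' → HasRealizer D d' → Data.Nat._≤_ d d')
  where import Data.Nat

{-# OPTIONS --safe #-}
module Submission where

-- Let f realize D − (u , v) in dimension d. As u and v are non-adjacent there, f u and f v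
-- tie. Prepend two coordinates that depend only on whether a vertex is u, v or neither:
-- the first puts u and v above every other vertex, the second puts them below, so on every
-- pair the two new coordinates cancel, except on {u , v}, where the first ties and the
-- second puts u above v. This breaks exactly the tie between u and v, in favour of u.

open import Defs
open import Data.Nat using (ℕ; _≤_; _<_; _+_; s≤s)
open import Data.Fin using (Fin)
open import Data.Nat.Properties
  using (+-assoc; +-comm; ≤-antisym; ≮⇒≥; ≤-reflexive; 1+n≰n; <⇒≤; +-cancelˡ-<; +-monoʳ-<)
open import Data.Fin.Properties using (_≟_)
open import Data.Bool using (true; false; if_then_else_)
open import Data.Bool.Properties using (∧-identityʳ; ∧-zeroʳ)
open import Data.Rational using (ℚ; 0ℚ; 1ℚ; ½)
open import Data.Rational.Properties using (_<?_)
open import Data.Vec.Functional using (_∷_)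
open import Data.Product using (_,_; _×_)
open import Data.Empty using (⊥-elim)
open import Function.Base using (_∘_)
open import Function.Related.Propositional using (module EquationalReasoning; equivalence)
open import Function.Bundles using (_⇔_; mk⇔; Equivalence)
open import Relation.Nullary using (¬_; does; yes; no; _×-dec_)
open import Relation.Binary.PropositionalEquality
  using (_≡_; _≢_; refl; sym; trans; cong; subst; subst₂; module ≡-Reasoning; ≡-≟-identity; ≢-≟-identity)

gt : ℚ → ℚ → ℕ
gt a b = if does (b <? a) then 1 else 0

countGreater-∷ : ∀ {d} a b (x y : Point d) →
  countGreater (a ∷ x) (b ∷ y) ≡ gt a b + countGreater x y
countGreater-∷ a b x y with does (b <? a)
... | true  = refl
... | false = refl

countGreater-∷∷ : ∀ {d} a a′ b b′ (x y : Point d) →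
  countGreater (a ∷ a′ ∷ x) (b ∷ b′ ∷ y) ≡ (gt a b + gt a′ b′) + countGreater x y
countGreater-∷∷ a a′ b b′ x y = begin
  countGreater (a ∷ a′ ∷ x) (b ∷ b′ ∷ y)  ≡⟨ countGreater-∷ a b (a′ ∷ x) (b′ ∷ y) ⟩
  gt a b + countGreater (a′ ∷ x) (b′ ∷ y) ≡⟨ cong (gt a b +_) (countGreater-∷ a′ b′ x y) ⟩
  gt a b + (gt a′ b′ + countGreater x y)  ≡⟨ +-assoc (gt a b) (gt a′ b′) _ ⟨
  (gt a b + gt a′ b′) + countGreater x y  ∎
  where open ≡-Reasoning

realizer-tie : ∀ {n d} {D : Digraph n} {f : Fin n → Point d} → IsRealizer D d f →
  ∀ {x y} → ¬ IsArc D x y → ¬ IsArc D y x →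
  countGreater (f x) (f y) ≡ countGreater (f y) (f x)
realizer-tie f-realizes {x} {y} x↛y y↛x = ≤-antisym
  (≮⇒≥ (λ fx≻fy → x↛y (Equivalence.from (f-realizes x y) fx≻fy)))
  (≮⇒≥ (λ fy≻fx → y↛x (Equivalence.from (f-realizes y x) fy≻fx)))

IsArc⇒≢ : ∀ {n} (D : Digraph n) {u v} → IsArc D u v → u ≢ v
IsArc⇒≢ D {u} u→u refl with () ← trans (sym (noLoop D u)) u→u

IsArc-asym : ∀ {n} (D : Digraph n) {u v} → IsArc D u v → ¬ IsArc D v u
IsArc-asym D {u} {v} u→v v→u with () ← trans (sym (antisym D u v u→v)) v→u

module _ {n} (D : Digraph n) (u v : Fin n) where

  deleteArc-removes : ¬ IsArc (deleteArc D u v) u v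
  deleteArc-removes
    rewrite ≡-≟-identity _≟_ (refl {x = u}) | ≡-≟-identity _≟_ (refl {x = v}) | ∧-zeroʳ (arc D u v)
    = λ ()

  deleteArc-keeps : ∀ {x y} → ¬ (x ≡ u × y ≡ v) → arc (deleteArc D u v) x y ≡ arc D x y
  deleteArc-keeps {x} {y} ¬uv with x ≟ u | y ≟ v
  ... | yes x≡u | yes y≡v = ⊥-elim (¬uv (x≡u , y≡v))
  ... | yes _   | no _    = ∧-identityʳ _
  ... | no _    | yes _   = ∧-identityʳ _
  ... | no _    | no _    = ∧-identityʳ _

  deleteArc-⊆ : ∀ {x y} → IsArc (deleteArc D u v) x y → IsArc D x y
  deleteArc-⊆ {x} {y} with arc D x y
  ... | true  = λ _ → refl
  ... | false = λ ()

data Role : Set where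
  source target other : Role

level : Role → ℚ
level source = 1ℚ
level target = 1ℚ
level other  = 0ℚ

tiebreak : Role → ℚ
tiebreak source = ½
tiebreak target = 0ℚ
tiebreak other  = 1ℚ

gain : Role → Role → ℕ
gain r s = gt (level r) (level s) + gt (tiebreak r) (tiebreak s)

gain-balanced : ∀ r s → ¬ (r ≡ source × s ≡ target) → ¬ (r ≡ target × s ≡ source) →
  gain r s ≡ gain s r
gain-balanced source source _ _ = refl
gain-balanced source target ¬st _ = ⊥-elim (¬st (refl , refl))
gain-balanced source other  _ _ = refl
gain-balanced target source _ ¬ts = ⊥-elim (¬ts (refl , refl))
gain-balanced target target _ _ = refl
gain-balanced target other  _ _ = refl
gain-balanced other  source _ _ = refl
gain-balanced other  target _ _ = refl
gain-balanced other  other  _ _ = refl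

module _ {n} (u v : Fin n) where

  role : Fin n → Role
  role x with x ≟ u | x ≟ v
  ... | yes _ | _     = source
  ... | no _  | yes _ = target
  ... | no _  | no _  = other

  role-source : role u ≡ source
  role-source rewrite ≡-≟-identity _≟_ (refl {x = u}) = refl

  role-target : v ≢ u → role v ≡ target
  role-target v≢u rewrite ≢-≟-identity _≟_ v≢u | ≡-≟-identity _≟_ (refl {x = v}) = refl

  role≡source⇒≡ : ∀ {x} → role x ≡ source → x ≡ u
  role≡source⇒≡ {x} with x ≟ u | x ≟ v
  ... | yes x≡u | _     = λ _ → x≡u
  ... | no _    | yes _ = λ ()
  ... | no _    | no _  = λ ()

  role≡target⇒≡ : ∀ {x} → role x ≡ target → x ≡ v
  role≡target⇒≡ {x} with x ≟ u | x ≟ v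
  ... | yes _ | _       = λ ()
  ... | no _  | yes x≡v = λ _ → x≡v
  ... | no _  | no _    = λ ()

module Extension {n d} (D : Digraph n) {u v : Fin n} (u→v : IsArc D u v)
                 (f : Fin n → Point d) (f-realizes : IsRealizer (deleteArc D u v) d f) where

  extend : Fin n → Point (2 + d)
  extend x = level (role u v x) ∷ tiebreak (role u v x) ∷ f x

  private
    c : Fin n → Fin n → ℕ
    c x y = countGreater (f x) (f y)

    γ : Fin n → Fin n → ℕ
    γ x y = gain (role u v x) (role u v y)

    v≢u : v ≢ u
    v≢u v≡u = IsArc⇒≢ D u→v (sym v≡u)

  countGreater-extend : ∀ x y → countGreater (extend x) (extend y) ≡ γ x y + c x y
  countGreater-extend x y = countGreater-∷∷ (level rx) (tiebreak rx) (level ry) (tiebreak ry) (f x) (f y)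
    where rx = role u v x; ry = role u v y

  extend-≻ : ∀ x y → (γ y x + c y x < γ x y + c x y) ⇔ (extend x ≻ extend y)
  extend-≻ x y = mk⇔ (subst₂ _<_ (sym (countGreater-extend y x)) (sym (countGreater-extend x y)))
                     (subst₂ _<_ (countGreater-extend y x) (countGreater-extend x y))

  γ-uv : γ u v ≡ 1
  γ-uv rewrite role-source u v | role-target u v v≢u = refl

  γ-vu : γ v u ≡ 0
  γ-vu rewrite role-source u v | role-target u v v≢u = refl

  c-tie : c u v ≡ c v u
  c-tie = realizer-tie {D = deleteArc D u v} {f = f} f-realizes (deleteArc-removes D u v)
            (λ v→u → IsArc-asym D u→v (deleteArc-⊆ D u v v→u))

  extend-≻-uv : extend u ≻ extend v
  extend-≻-uv = Equivalence.to (extend-≻ u v)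
    (subst₂ (λ k l → k + c v u < l + c u v) (sym γ-vu) (sym γ-uv) (s≤s (≤-reflexive (sym c-tie))))

  extend-⊁-vu : ¬ (extend v ≻ extend u)
  extend-⊁-vu v≻u = 1+n≰n (subst (1 + c u v ≤_) (sym c-tie) (<⇒≤ 1+cuv<cvu))
    where
    1+cuv<cvu : 1 + c u v < 0 + c v u
    1+cuv<cvu = subst₂ (λ k l → k + c u v < l + c v u) γ-uv γ-vu (Equivalence.from (extend-≻ v u) v≻u)

  extend-realizes-balanced : ∀ x y → ¬ (x ≡ u × y ≡ v) → ¬ (x ≡ v × y ≡ u) →
    IsArc D x y ⇔ (extend x ≻ extend y)
  extend-realizes-balanced x y ¬uv ¬vu = begin
    IsArc D x y                    ≡⟨ cong (_≡ true) (deleteArc-keeps D u v ¬uv) ⟨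
    IsArc (deleteArc D u v) x y    ∼⟨ f-realizes x y ⟩
    c y x < c x y                  ∼⟨ mk⇔ (+-monoʳ-< (γ x y)) (+-cancelˡ-< (γ x y) _ _) ⟩
    γ x y + c y x < γ x y + c x y  ≡⟨ cong (λ k → k + c y x < γ x y + c x y) γ-balanced ⟩
    γ y x + c y x < γ x y + c x y  ∼⟨ extend-≻ x y ⟩
    extend x ≻ extend y            ∎
    where
    open EquationalReasoning {k = equivalence}
    γ-balanced : γ x y ≡ γ y x
    γ-balanced = gain-balanced (role u v x) (role u v y)
      (λ (x-source , y-target) → ¬uv (role≡source⇒≡ u v x-source , role≡target⇒≡ u v y-target))
      (λ (x-target , y-source) → ¬vu (role≡target⇒≡ u v x-target , role≡source⇒≡ u v y-source))

  extend-realizes : IsRealizer D (2 + d) extend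
  extend-realizes x y with (x ≟ u) ×-dec (y ≟ v) | (x ≟ v) ×-dec (y ≟ u)
  ... | yes (refl , refl) | _                 = mk⇔ (λ _ → extend-≻-uv) (λ _ → u→v)
  ... | no _              | yes (refl , refl) = mk⇔ (⊥-elim ∘ IsArc-asym D u→v) (⊥-elim ∘ extend-⊁-vu)
  ... | no ¬uv            | no ¬vu            = extend-realizes-balanced x y ¬uv ¬vu

proposition2p3 : ∀ {n} (D : Digraph n) (u v : Fin n) → IsArc D u v →
    ∀ (d₁ d₂ : ℕ) → IsDim D d₁ → IsDim (deleteArc D u v) d₂ → d₁ ≤ d₂ + 2
proposition2p3 D u v u→v d₁ d₂ (_ , d₁-minimal) ((f , f-realizes) , _) =
  subst (d₁ ≤_) (+-comm 2 d₂) (d₁-minimal (2 + d₂) (extend , extend-realizes))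
  where open Extension D u→v f f-realizes
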